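{- Let $d=(d_1,\dots,d_n)$ be a degree sequence with complementary sequence $\overline{d}=(n-1-d_n,\dots,n-1-d_1)$. For $i\in\{0,\dots,n\}$ let $\sigma(d,i)$ denote the sum of all entries in the first $i$ rows of $M(d)$. Then \[\sigma(d,i)=\begin{cases}\Delta_i(d) & \text{if } 0\le i\le m(d);\\ \Delta_{n-i}(\overline{d}) & \text{if } n-m(\overline{d})\le i\le n.\end{cases}\]
   Context: A degree sequence is the list of vertex degrees of a finite simple graph in nonincreasing order. $m(d)=\max\{i:d_i\ge i-1\}$. For $k\ge 0$, $\Delta_k(d)=k(k-1)+\sum_{i>k}\min\{k,d_i\}-\sum_{i\le k}d_i$. The corrected Ferrers diagram $F(d)$ is the $n\times n$ matrix with stars on the main diagonal in which, for each $i$, the first $d_i$ non-diagonal entries of row $i$ equal $1$ and all other non-diagonal entries equal $0$; stars have numerical value $0$. The difference matrix is $M(d)=F(d)^T-F(d)$. -}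

module Defs where

open import Data.Nat using (ℕ; zero; suc; _+_; _*_; _∸_; _≤_; _<_; _⊔_; _⊓_; _≤?_; _<?_)
open import Data.Integer as ℤ using (ℤ; +_)
open import Data.Fin using (Fin; toℕ; opposite; _≟_)
import Data.Fin as F
open import Data.Bool using (Bool; true; false; if_then_else_)
open import Data.Product using (Σ; _×_; ∃)
open import Relation.Nullary using (does)
open import Relation.Binary.PropositionalEquality using (_≡_)

sumℕ : ∀ {n} → (Fin n → ℕ) → ℕ
sumℕ {zero}  f = 0
sumℕ {suc n} f = f F.zero + sumℕ (λ j → f (F.suc j))

sumℤ : ∀ {n} → (Fin n → ℤ) → ℤ
sumℤ {zero}  f = + 0
sumℤ {suc n} f = f F.zero ℤ.+ sumℤ (λ j → f (F.suc j))

record Graph (n : ℕ) : Set where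
  field
    adj   : Fin n → Fin n → Bool
    sym   : ∀ i j → adj i j ≡ adj j i
    irrefl : ∀ i → adj i i ≡ false

deg : ∀ {n} → Graph n → Fin n → ℕ
deg G i = sumℕ (λ j → if Graph.adj G i j then 1 else 0)

-- Sequences d = (d_1,…,d_n) are functions Fin n → ℕ (0-indexed: d_1 is d zero)
Nonincreasing : ∀ {n} → (Fin n → ℕ) → Set
Nonincreasing d = ∀ i j → i F.≤ j → d j ≤ d i

IsDegreeSequence : ∀ {n} → (Fin n → ℕ) → Set
IsDegreeSequence {n} d = Nonincreasing d × Σ (Graph n) (λ G → ∀ i → deg G i ≡ d i)

-- complementary sequence: dbar_j = n-1-d_{n+1-j} (1-indexed)
complement : ∀ {n} → (Fin n → ℕ) → Fin n → ℕ
complement {n} d j = (n ∸ 1) ∸ d (opposite j)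

-- m(d) = max{ i : d_i ≥ i - 1 } (1-indexed); 0-indexed j = i-1: max{ j+1 : d j ≥ j },
-- with max ∅ = 0 (only relevant when n = 0)
maxFin : ∀ {n} → (Fin n → ℕ) → ℕ
maxFin {zero}  f = 0
maxFin {suc n} f = f F.zero ⊔ maxFin (λ j → f (F.suc j))

mOf : ∀ {n} → (Fin n → ℕ) → ℕ
mOf d = maxFin (λ j → if does (toℕ j ≤? d j) then suc (toℕ j) else 0)

-- Δ_k(d) = k(k-1) + Σ_{i>k} min{k,d_i} - Σ_{i≤k} d_i   (1-indexed i; 0-indexed j = i-1)
Δ : ∀ {n} → ℕ → (Fin n → ℕ) → ℤ
Δ k d = (+ (k * (k ∸ 1) + sumℕ (λ j → if does (k ≤? toℕ j) then k ⊓ d j else 0)))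
        ℤ.- (+ sumℕ (λ j → if does (toℕ j <? k) then d j else 0))

-- corrected Ferrers diagram F(d): diagonal entries (stars) have value 0; in row i the
-- non-diagonal entry in column j is the p-th non-diagonal entry (0-indexed) where
-- p = j if j < i and p = j - 1 if j > i; it equals 1 iff p < d_i.
ferrers : ∀ {n} → (Fin n → ℕ) → Fin n → Fin n → ℤ
ferrers d i j with does (i ≟ j)
... | true  = + 0
... | false = if does (pos <? d i) then + 1 else + 0
  where
    pos : ℕ
    pos = if does (toℕ j <? toℕ i) then toℕ j else toℕ j ∸ 1

diffM : ∀ {n} → (Fin n → ℕ) → Fin n → Fin n → ℤ
diffM d i j = ferrers d j i ℤ.- ferrers d i j

σ : ∀ {n} → (Fin n → ℕ) → ℕ → ℤ
σ d i = sumℤ (λ r → if does (toℕ r <? i) then sumℤ (λ c → diffM d r c) else + 0)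

-- σ(d,i) counts the ones of F(d) in its first i columns minus those in its first i rows.
-- Row c of F(d) has its d_c ≤ n-1 ones in its first d_c off-diagonal positions, so it
-- meets the first i columns in min(i - [c < i], d_c) ones, while the first i rows hold
-- Σ_{c<i} d_c ones.  If i ≤ m(d) then d_c ≥ i-1 for every c < i, and the column count is
-- i(i-1) + Σ_{c≥i} min(i, d_c): this is Δ_i(d).  If n - m(d̄) ≤ i, the same bound for d̄
-- says d_c ≤ i for every c ≥ i; reindexing Δ_{n-i}(d̄) along c ↦ n-1-c, both sides then
-- agree row by row.
module Submission where

open import Defs
open import Data.Nat using (ℕ; _≤_; _∸_)
open import Data.Fin using (Fin)
open import Data.Product using (_×_)
open import Relation.Binary.PropositionalEquality using (_≡_)

open import Data.Bool using (true; false; if_then_else_)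
open import Data.Bool.Properties using (if-float; if-cong; if-cong-then)
open import Data.Fin as Fin using (toℕ; opposite; inject₁; fromℕ)
open import Data.Fin.Properties
  using (toℕ<n; toℕ-inject₁; toℕ-fromℕ; toℕ-injective; opposite-prop; opposite-involutive)
import Data.Fin.Permutation as Perm
open import Data.Integer as ℤ using (ℤ; +_; -_; _⊖_)
open import Data.Integer.Properties as ℤ using (pos-+; neg-distrib-+; [+m]-[+n]≡m⊖n; +-cancelˡ-⊖)
open import Algebra.Properties.CommutativeSemigroup ℤ.+-commutativeSemigroup using (interchange)
import Data.Nat as ℕ
open import Data.Nat
  using (zero; suc; _+_; _*_; _<_; _⊓_; _≤′_; ≤′-refl; ≤′-step; _≤?_; _<?_; z≤n; s≤s; s≤s⁻¹; z<s)
open import Data.Nat.Properties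
open import Algebra.Properties.CommutativeMonoid.Sum +-0-commutativeMonoid
  using (sum; sum-cong-≗; ∑-distrib-+; ∑-comm; sum-permute; sum-remove; sum-init-last)
open import Data.Nat.Tactic.RingSolver using (solve-∀)
open import Data.Product using (_,_; ∃; proj₁)
open import Data.Sum using (inj₁; inj₂)
open import Function using (_∘_; _⇔_; mk⇔; Equivalence)
open import Relation.Binary using (Tri; tri<; tri≈; tri>)
open import Relation.Binary.PropositionalEquality
  using (refl; sym; trans; cong; cong₂; subst; subst₂; _≗_; module ≡-Reasoning)
open import Relation.Nullary using (Dec; does; yes; no; ¬_; contradiction)
open import Relation.Nullary.Decidable using (dec-true; dec-false; does-⇔)

if-yes : ∀ {p a} {P : Set p} {A : Set a} (P? : Dec P) → P → ∀ {x y : A} → (if does P? then x else y) ≡ x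
if-yes P? p = if-cong (dec-true P? p)

if-no : ∀ {p a} {P : Set p} {A : Set a} (P? : Dec P) → ¬ P → ∀ {x y : A} → (if does P? then x else y) ≡ y
if-no P? ¬p = if-cong (dec-false P? ¬p)

sumℕ≡sum : ∀ {n} (f : Fin n → ℕ) → sumℕ f ≡ sum f
sumℕ≡sum {zero}  f = refl
sumℕ≡sum {suc n} f = cong (_+_ (f Fin.zero)) (sumℕ≡sum (f ∘ Fin.suc))

sumℕ-cong : ∀ {n} {f g : Fin n → ℕ} → f ≗ g → sumℕ f ≡ sumℕ g
sumℕ-cong {f = f} {g} f≗g =
  trans (sumℕ≡sum f) (trans (sum-cong-≗ f≗g) (sym (sumℕ≡sum g)))

sumℕ-const : ∀ n a → sumℕ {n} (λ _ → a) ≡ n * a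
sumℕ-const zero    a = refl
sumℕ-const (suc n) a = cong (_+_ a) (sumℕ-const n a)

sumℕ-≤ : ∀ {n b} (f : Fin n → ℕ) → (∀ c → f c ≤ b) → sumℕ f ≤ n * b
sumℕ-≤ {zero}  f f≤b = z≤n
sumℕ-≤ {suc n} f f≤b = +-mono-≤ (f≤b Fin.zero) (sumℕ-≤ (f ∘ Fin.suc) (f≤b ∘ Fin.suc))

sumℕ-distrib-+ : ∀ {n} (f g : Fin n → ℕ) → sumℕ (λ c → f c + g c) ≡ sumℕ f + sumℕ g
sumℕ-distrib-+ f g = begin
  sumℕ (λ c → f c + g c) ≡⟨ sumℕ≡sum (λ c → f c + g c) ⟩
  sum (λ c → f c + g c)  ≡⟨ ∑-distrib-+ f g ⟩
  sum f + sum g          ≡⟨ cong₂ _+_ (sumℕ≡sum f) (sumℕ≡sum g) ⟨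
  sumℕ f + sumℕ g        ∎
  where open ≡-Reasoning

sumℕ-distrib-+₃ : ∀ {n} (f g h : Fin n → ℕ) →
  sumℕ (λ c → f c + g c + h c) ≡ sumℕ f + sumℕ g + sumℕ h
sumℕ-distrib-+₃ f g h = trans (sumℕ-distrib-+ (λ c → f c + g c) h) (cong (_+ sumℕ h) (sumℕ-distrib-+ f g))

if-sumℕ : ∀ {n} b (f : Fin n → ℕ) → (if b then sumℕ f else 0) ≡ sumℕ (λ c → if b then f c else 0)
if-sumℕ         true  f = refl
if-sumℕ {n = n} false f = sym (trans (sumℕ-const n 0) (*-zeroʳ n))

sumℕ-comm : ∀ {m n} (h : Fin m → Fin n → ℕ) →
  sumℕ (λ r → sumℕ (h r)) ≡ sumℕ (λ c → sumℕ (λ r → h r c))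
sumℕ-comm h = begin
  sumℕ (λ r → sumℕ (h r))             ≡⟨ sumℕ≡sum (λ r → sumℕ (h r)) ⟩
  sum (λ r → sumℕ (h r))              ≡⟨ sum-cong-≗ (λ r → sumℕ≡sum (h r)) ⟩
  sum (λ r → sum (h r))               ≡⟨ ∑-comm h ⟩
  sum (λ c → sum (λ r → h r c))       ≡⟨ sum-cong-≗ (λ c → sumℕ≡sum (λ r → h r c)) ⟨
  sum (λ c → sumℕ (λ r → h r c))      ≡⟨ sumℕ≡sum (λ c → sumℕ (λ r → h r c)) ⟨
  sumℕ (λ c → sumℕ (λ r → h r c))     ∎
  where open ≡-Reasoning

sumℕ-remove : ∀ {n} (f : Fin (suc n) → ℕ) i → sumℕ f ≡ f i + sumℕ (f ∘ Fin.punchIn i)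
sumℕ-remove f i =
  trans (sumℕ≡sum f) (trans (sum-remove f) (cong (_+_ (f i)) (sym (sumℕ≡sum (f ∘ Fin.punchIn i)))))

sumℕ-reverse : ∀ {n} (f : Fin n → ℕ) → sumℕ f ≡ sumℕ (f ∘ opposite)
sumℕ-reverse f = trans (sumℕ≡sum f) (trans (sum-permute f Perm.reverse) (sym (sumℕ≡sum (f ∘ opposite))))

opposite<∸⇔≤ : ∀ {n} i (c : Fin n) → toℕ (opposite c) < n ∸ i ⇔ i ≤ toℕ c
opposite<∸⇔≤ {n} i c rewrite opposite-prop c =
  mk⇔ (s≤s⁻¹ ∘ ∸-cancelʳ-<) (λ i≤c → ∸-monoʳ-< (s≤s i≤c) (toℕ<n c))

∸≤opposite⇔< : ∀ {n} i (c : Fin n) → n ∸ i ≤ toℕ (opposite c) ⇔ toℕ c < i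
∸≤opposite⇔< {n} i c = mk⇔
  (λ k≤c̄ → ≰⇒> λ i≤c → <⇒≱ (Equivalence.from (opposite<∸⇔≤ i c) i≤c) k≤c̄)
  (λ c<i → subst (n ∸ i ≤_) (sym (opposite-prop c)) (∸-monoʳ-≤ n c<i))

sumℕ-opposite-below : ∀ {n} i (f : Fin n → ℕ) →
  sumℕ (λ j → if does (toℕ j <? n ∸ i) then f j else 0)
    ≡ sumℕ (λ c → if does (i ≤? toℕ c) then f (opposite c) else 0)
sumℕ-opposite-below {n} i f = trans (sumℕ-reverse {n} _)
  (sumℕ-cong λ c → if-cong (does-⇔ (opposite<∸⇔≤ i c) (toℕ (opposite c) <? n ∸ i) (i ≤? toℕ c)))

sumℕ-opposite-from : ∀ {n} i (f : Fin n → ℕ) →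
  sumℕ (λ j → if does (n ∸ i ≤? toℕ j) then f j else 0)
    ≡ sumℕ (λ c → if does (toℕ c <? i) then f (opposite c) else 0)
sumℕ-opposite-from {n} i f = trans (sumℕ-reverse {n} _)
  (sumℕ-cong λ c → if-cong (does-⇔ (∸≤opposite⇔< i c) (n ∸ i ≤? toℕ (opposite c)) (toℕ c <? i)))

sumℕ-toℕ-snoc : ∀ n (g : ℕ → ℕ) → sumℕ {suc n} (g ∘ toℕ) ≡ sumℕ {n} (g ∘ toℕ) + g n
sumℕ-toℕ-snoc n g = begin
  sumℕ {suc n} (g ∘ toℕ)
    ≡⟨ sumℕ≡sum {suc n} (g ∘ toℕ) ⟩
  sum {suc n} (g ∘ toℕ)
    ≡⟨ sum-init-last {n} (g ∘ toℕ) ⟩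
  sum {n} (g ∘ toℕ ∘ inject₁) + g (toℕ (fromℕ n))
    ≡⟨ cong₂ _+_ (sum-cong-≗ {n} (cong g ∘ toℕ-inject₁)) (cong g (toℕ-fromℕ n)) ⟩
  sum {n} (g ∘ toℕ) + g n
    ≡⟨ cong (_+ g n) (sumℕ≡sum {n} (g ∘ toℕ)) ⟨
  sumℕ {n} (g ∘ toℕ) + g n ∎
  where open ≡-Reasoning

sumℕ-below : ∀ {i n} → i ≤′ n → (g : ℕ → ℕ) →
  sumℕ {n} (λ x → if does (toℕ x <? i) then g (toℕ x) else 0) ≡ sumℕ {i} (g ∘ toℕ)
sumℕ-below {i} ≤′-refl g =
  sumℕ-cong (λ x → if-yes (toℕ x <? i) (toℕ<n x))
sumℕ-below {i} (≤′-step {n} i≤′n) g = begin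
  sumℕ {suc n} (g<i ∘ toℕ)      ≡⟨ sumℕ-toℕ-snoc n g<i ⟩
  sumℕ {n} (g<i ∘ toℕ) + g<i n  ≡⟨ cong₂ _+_ (sumℕ-below i≤′n g) n≮i ⟩
  sumℕ {i} (g ∘ toℕ) + 0        ≡⟨ +-identityʳ _ ⟩
  sumℕ {i} (g ∘ toℕ)            ∎
  where
  open ≡-Reasoning
  g<i : ℕ → ℕ
  g<i x = if does (x <? i) then g x else 0
  n≮i : g<i n ≡ 0
  n≮i = if-no (n <? i) (≤⇒≯ (≤′⇒≤ i≤′n))

sumℕ-below-const : ∀ {n i} → i ≤ n → ∀ a → sumℕ {n} (λ x → if does (toℕ x <? i) then a else 0) ≡ i * a
sumℕ-below-const {i = i} i≤n a = trans (sumℕ-below (≤⇒≤′ i≤n) (λ _ → a)) (sumℕ-const i a)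

sumℕ-from : ∀ {i n} → i ≤′ n → ∀ a →
  sumℕ {n} (λ x → if does (i ≤? toℕ x) then a else 0) ≡ (n ∸ i) * a
sumℕ-from {n = n} ≤′-refl a = begin
  sumℕ {n} (λ x → if does (n ≤? toℕ x) then a else 0) ≡⟨ sumℕ-cong x≱n ⟩
  sumℕ {n} (λ _ → 0)                                   ≡⟨ sumℕ-const n 0 ⟩
  n * 0                                                ≡⟨ *-zeroʳ n ⟩
  0                                                    ≡⟨ cong (_* a) (n∸n≡0 n) ⟨
  (n ∸ n) * a                                          ∎
  where
  open ≡-Reasoning
  x≱n : ∀ x → (if does (n ≤? toℕ x) then a else 0) ≡ 0
  x≱n x = if-no (n ≤? toℕ x) (<⇒≱ (toℕ<n x))
sumℕ-from {i} (≤′-step {n} i≤′n) a = begin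
  sumℕ {suc n} (a≥i ∘ toℕ)      ≡⟨ sumℕ-toℕ-snoc n a≥i ⟩
  sumℕ {n} (a≥i ∘ toℕ) + a≥i n  ≡⟨ cong₂ _+_ (sumℕ-from i≤′n a) (if-yes (i ≤? n) i≤n) ⟩
  (n ∸ i) * a + a               ≡⟨ +-comm _ a ⟩
  suc (n ∸ i) * a               ≡⟨ cong (_* a) (+-∸-assoc 1 i≤n) ⟨
  (suc n ∸ i) * a               ∎
  where
  open ≡-Reasoning
  i≤n : i ≤ n
  i≤n = ≤′⇒≤ i≤′n
  a≥i : ℕ → ℕ
  a≥i x = if does (i ≤? x) then a else 0

sumℤ-cong : ∀ {n} {f g : Fin n → ℤ} → f ≗ g → sumℤ f ≡ sumℤ g
sumℤ-cong {zero}  f≗g = refl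
sumℤ-cong {suc n} f≗g = cong₂ ℤ._+_ (f≗g Fin.zero) (sumℤ-cong (f≗g ∘ Fin.suc))

sumℤ-difference : ∀ {n} (f g : Fin n → ℕ) → sumℤ (λ c → + f c ℤ.- + g c) ≡ + sumℕ f ℤ.- + sumℕ g
sumℤ-difference {zero}  f g = refl
sumℤ-difference {suc n} f g = begin
  (+ f₀ ℤ.- + g₀) ℤ.+ sumℤ (λ c → + f (Fin.suc c) ℤ.- + g (Fin.suc c))
    ≡⟨ cong (λ x → (+ f₀ ℤ.- + g₀) ℤ.+ x) (sumℤ-difference (f ∘ Fin.suc) (g ∘ Fin.suc)) ⟩
  (+ f₀ ℤ.- + g₀) ℤ.+ (+ F ℤ.- + G)
    ≡⟨ interchange (+ f₀) (- + g₀) (+ F) (- + G) ⟩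
  (+ f₀ ℤ.+ + F) ℤ.+ (- + g₀ ℤ.+ - + G)
    ≡⟨ cong₂ (λ x y → x ℤ.+ y) (pos-+ f₀ F) (neg-distrib-+ (+ g₀) (+ G)) ⟨
  + (f₀ + F) ℤ.- (+ g₀ ℤ.+ + G)
    ≡⟨ cong (λ x → + (f₀ + F) ℤ.- x) (pos-+ g₀ G) ⟨
  + (f₀ + F) ℤ.- + (g₀ + G) ∎
  where
  open ≡-Reasoning
  f₀ g₀ F G : ℕ
  f₀ = f Fin.zero
  g₀ = g Fin.zero
  F = sumℕ (f ∘ Fin.suc)
  G = sumℕ (g ∘ Fin.suc)

m⊓n+[m<n]≡1+m⊓n : ∀ m n → m ⊓ n + (if does (m <? n) then 1 else 0) ≡ suc m ⊓ n
m⊓n+[m<n]≡1+m⊓n zero    zero    = refl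
m⊓n+[m<n]≡1+m⊓n zero    (suc n) = refl
m⊓n+[m<n]≡1+m⊓n (suc m) zero    = refl
m⊓n+[m<n]≡1+m⊓n (suc m) (suc n) = cong suc (m⊓n+[m<n]≡1+m⊓n m n)

m⊓o+n≡n⊓[m+n∸o]+o : ∀ m n {o} → o ≤ m + n → m ⊓ o + n ≡ n ⊓ (m + n ∸ o) + o
m⊓o+n≡n⊓[m+n∸o]+o m n {o} o≤m+n with ≤-total o m
... | inj₁ o≤m = begin
  m ⊓ o + n            ≡⟨ cong (_+ n) (m≥n⇒m⊓n≡n o≤m) ⟩
  o + n                ≡⟨ +-comm o n ⟩
  n + o                ≡⟨ cong (_+ o) (m≤n⇒m⊓n≡m n≤m+n∸o) ⟨
  n ⊓ (m + n ∸ o) + o  ∎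
  where
  open ≡-Reasoning
  n≤m+n∸o : n ≤ m + n ∸ o
  n≤m+n∸o = subst (n ≤_) (sym (+-∸-comm n o≤m)) (m≤n+m n (m ∸ o))
... | inj₂ m≤o = begin
  m ⊓ o + n            ≡⟨ cong (_+ n) (m≤n⇒m⊓n≡m m≤o) ⟩
  m + n                ≡⟨ m∸n+n≡m o≤m+n ⟨
  m + n ∸ o + o        ≡⟨ cong (_+ o) (m≥n⇒m⊓n≡n m+n∸o≤n) ⟨
  n ⊓ (m + n ∸ o) + o  ∎
  where
  open ≡-Reasoning
  m+n∸o≤n : m + n ∸ o ≤ n
  m+n∸o≤n = subst (m + n ∸ o ≤_) (m+n∸m≡n o n) (∸-monoˡ-≤ o (+-monoˡ-≤ n m≤o))

n∸1≡[i∸1]+[n∸i] : ∀ {n i} → 0 < i → i ≤ n → n ∸ 1 ≡ (i ∸ 1) + (n ∸ i)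
n∸1≡[i∸1]+[n∸i] {n} {i} 0<i i≤n = trans (cong (_∸ 1) (sym (m+[n∸m]≡n i≤n))) (+-∸-comm (n ∸ i) 0<i)

k*[i+k∸1]≡k*[k∸1]+i*k : ∀ i k → k * (i + k ∸ 1) ≡ k * (k ∸ 1) + i * k
k*[i+k∸1]≡k*[k∸1]+i*k i zero    = sym (*-zeroʳ i)
k*[i+k∸1]≡k*[k∸1]+i*k i (suc k) = begin
  suc k * (i + suc k ∸ 1)  ≡⟨ cong (λ x → suc k * (x ∸ 1)) (+-suc i k) ⟩
  suc k * (i + k)          ≡⟨ *-distribˡ-+ (suc k) i k ⟩
  suc k * i + suc k * k    ≡⟨ +-comm (suc k * i) (suc k * k) ⟩
  suc k * k + suc k * i    ≡⟨ cong (_+_ (suc k * k)) (*-comm (suc k) i) ⟩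
  suc k * k + i * suc k    ∎
  where open ≡-Reasoning

a+b+c+d≡a+c+d+b : ∀ a b c d → a + b + c + d ≡ a + c + d + b
a+b+c+d≡a+c+d+b = solve-∀

[+a]-[+b]≡[+c]-[+d] : ∀ a b c d → a + d ≡ c + b → + a ℤ.- + b ≡ + c ℤ.- + d
[+a]-[+b]≡[+c]-[+d] a b c d a+d≡c+b = begin
  + a ℤ.- + b        ≡⟨ [+m]-[+n]≡m⊖n a b ⟩
  a ⊖ b              ≡⟨ +-cancelˡ-⊖ d a b ⟨
  (d + a) ⊖ (d + b)  ≡⟨ cong₂ _⊖_ (trans (+-comm d a) (trans a+d≡c+b (+-comm c b))) (+-comm d b) ⟩
  (b + c) ⊖ (b + d)  ≡⟨ +-cancelˡ-⊖ b c d ⟩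
  c ⊖ d              ≡⟨ [+m]-[+n]≡m⊖n c d ⟨
  + c ℤ.- + d        ∎
  where open ≡-Reasoning

-- The corrected Ferrers diagram

-- The rank of column x among the off-diagonal columns of row a.
position : ℕ → ℕ → ℕ
position a x = if does (x <? a) then x else x ∸ 1

ferrersEntry : ℕ → ℕ → ℕ → ℕ
ferrersEntry a e x = if does (a ℕ.≟ x) then 0 else (if does (position a x <? e) then 1 else 0)

ferrers≡ferrersEntry : ∀ {n} (d : Fin n → ℕ) i j → ferrers d i j ≡ + ferrersEntry (toℕ i) (d i) (toℕ j)
ferrers≡ferrersEntry d i j with i Fin.≟ j
... | yes i≡j = cong +_ (sym (if-yes (toℕ i ℕ.≟ toℕ j) (cong toℕ i≡j)))
... | no i≢j = trans (sym (if-float +_ (does (position (toℕ i) (toℕ j) <? d i))))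
  (cong +_ (sym (if-no (toℕ i ℕ.≟ toℕ j) (i≢j ∘ toℕ-injective))))

ferrersEntry-diagonal : ∀ a e → ferrersEntry a e a ≡ 0
ferrersEntry-diagonal a e = if-yes (a ℕ.≟ a) refl

ferrersEntry-< : ∀ {a x} e → x < a → ferrersEntry a e x ≡ (if does (x <? e) then 1 else 0)
ferrersEntry-< {a} {x} e x<a =
  trans (if-no (a ℕ.≟ x) (>⇒≢ x<a)) (if-cong (cong (does ∘ (_<? e)) (if-yes (x <? a) x<a)))

ferrersEntry-> : ∀ {a x} e → a < x → ferrersEntry a e x ≡ (if does (x ∸ 1 <? e) then 1 else 0)
ferrersEntry-> {a} {x} e a<x =
  trans (if-no (a ℕ.≟ x) (<⇒≢ a<x)) (if-cong (cong (does ∘ (_<? e)) (if-no (x <? a) (<⇒≯ a<x))))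

-- The number of columns x < t with x ≠ a.
offDiagonal : ℕ → ℕ → ℕ
offDiagonal a t = if does (a <? t) then t ∸ 1 else t

offDiagonal-< : ∀ {a t} → a < t → offDiagonal a t ≡ t ∸ 1
offDiagonal-< {a} {t} a<t = if-yes (a <? t) a<t

offDiagonal-≥ : ∀ {a t} → t ≤ a → offDiagonal a t ≡ t
offDiagonal-≥ {a} {t} t≤a = if-no (a <? t) (≤⇒≯ t≤a)

ferrersEntry-prefix : ∀ a e t → sumℕ {t} (ferrersEntry a e ∘ toℕ) ≡ offDiagonal a t ⊓ e
ferrersEntry-prefix a e zero = cong (_⊓ e) (sym (offDiagonal-≥ {a} z≤n))
ferrersEntry-prefix a e (suc t) = trans (sumℕ-toℕ-snoc t (ferrersEntry a e)) (step (<-cmp t a))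
  where
  open ≡-Reasoning
  step : Tri (t < a) (t ≡ a) (a < t) →
    sumℕ {t} (ferrersEntry a e ∘ toℕ) + ferrersEntry a e t ≡ offDiagonal a (suc t) ⊓ e
  step (tri< t<a _ _) = begin
    sumℕ {t} (ferrersEntry a e ∘ toℕ) + ferrersEntry a e t
      ≡⟨ cong₂ _+_ (ferrersEntry-prefix a e t) (ferrersEntry-< e t<a) ⟩
    offDiagonal a t ⊓ e + (if does (t <? e) then 1 else 0)
      ≡⟨ cong (λ o → o ⊓ e + _) (offDiagonal-≥ (<⇒≤ t<a)) ⟩
    t ⊓ e + (if does (t <? e) then 1 else 0)
      ≡⟨ m⊓n+[m<n]≡1+m⊓n t e ⟩
    suc t ⊓ e
      ≡⟨ cong (_⊓ e) (offDiagonal-≥ t<a) ⟨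
    offDiagonal a (suc t) ⊓ e ∎
  step (tri≈ _ refl _) = begin
    sumℕ {t} (ferrersEntry t e ∘ toℕ) + ferrersEntry t e t
      ≡⟨ cong₂ _+_ (ferrersEntry-prefix t e t) (ferrersEntry-diagonal t e) ⟩
    offDiagonal t t ⊓ e + 0
      ≡⟨ +-identityʳ _ ⟩
    offDiagonal t t ⊓ e
      ≡⟨ cong (_⊓ e) (trans (offDiagonal-≥ ≤-refl) (sym (offDiagonal-< (n<1+n t)))) ⟩
    offDiagonal t (suc t) ⊓ e ∎
  step (tri> _ _ a<t@(s≤s {n = t′} _)) = begin
    sumℕ {t} (ferrersEntry a e ∘ toℕ) + ferrersEntry a e t
      ≡⟨ cong₂ _+_ (ferrersEntry-prefix a e t) (ferrersEntry-> e a<t) ⟩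
    offDiagonal a t ⊓ e + (if does (t′ <? e) then 1 else 0)
      ≡⟨ cong (λ o → o ⊓ e + _) (offDiagonal-< a<t) ⟩
    t′ ⊓ e + (if does (t′ <? e) then 1 else 0)
      ≡⟨ m⊓n+[m<n]≡1+m⊓n t′ e ⟩
    t ⊓ e
      ≡⟨ cong (_⊓ e) (offDiagonal-< (m<n⇒m<1+n a<t)) ⟨
    offDiagonal a (suc t) ⊓ e ∎

ferrersℕ : ∀ {n} → (Fin n → ℕ) → Fin n → Fin n → ℕ
ferrersℕ d r c = ferrersEntry (toℕ r) (d r) (toℕ c)

ferrersℕ-rowSum : ∀ {n} (d : Fin n → ℕ) r → sumℕ (ferrersℕ d r) ≡ (n ∸ 1) ⊓ d r
ferrersℕ-rowSum {n} d r =
  trans (ferrersEntry-prefix (toℕ r) (d r) n) (cong (_⊓ d r) (offDiagonal-< (toℕ<n r)))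

-- The number of ones of row c of F(d) in its first i columns.
prefixOnes : ∀ {n} → (Fin n → ℕ) → ℕ → Fin n → ℕ
prefixOnes d i c = offDiagonal (toℕ c) i ⊓ d c

ferrersℕ-firstColumns : ∀ {n i} (d : Fin n → ℕ) → i ≤ n →
  sumℕ (λ r → if does (toℕ r <? i) then sumℕ (λ c → ferrersℕ d c r) else 0) ≡ sumℕ (prefixOnes d i)
ferrersℕ-firstColumns {n} {i} d i≤n = begin
  sumℕ (λ r → if does (toℕ r <? i) then sumℕ (λ c → ferrersℕ d c r) else 0)
    ≡⟨ sumℕ-cong (λ r → if-sumℕ (does (toℕ r <? i)) (λ c → ferrersℕ d c r)) ⟩
  sumℕ (λ r → sumℕ (λ c → if does (toℕ r <? i) then ferrersℕ d c r else 0))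
    ≡⟨ sumℕ-comm (λ r c → if does (toℕ r <? i) then ferrersℕ d c r else 0) ⟩
  sumℕ (λ c → sumℕ (λ r → if does (toℕ r <? i) then ferrersℕ d c r else 0))
    ≡⟨ sumℕ-cong (λ c → sumℕ-below (≤⇒≤′ i≤n) (ferrersEntry (toℕ c) (d c))) ⟩
  sumℕ (λ c → sumℕ {i} (ferrersEntry (toℕ c) (d c) ∘ toℕ))
    ≡⟨ sumℕ-cong (λ c → ferrersEntry-prefix (toℕ c) (d c) i) ⟩
  sumℕ (prefixOnes d i) ∎
  where open ≡-Reasoning

diffM-rowSum : ∀ {n} (d : Fin n → ℕ) r →
  sumℤ (diffM d r) ≡ + sumℕ (λ c → ferrersℕ d c r) ℤ.- + sumℕ (ferrersℕ d r)
diffM-rowSum d r = trans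
  (sumℤ-cong (λ c → cong₂ ℤ._-_ (ferrers≡ferrersEntry d c r) (ferrers≡ferrersEntry d r c)))
  (sumℤ-difference (λ c → ferrersℕ d c r) (ferrersℕ d r))

σ≡firstColumns-firstRows : ∀ {n} (d : Fin n → ℕ) i →
  σ d i ≡ + sumℕ (λ r → if does (toℕ r <? i) then sumℕ (λ c → ferrersℕ d c r) else 0)
          ℤ.- + sumℕ (λ r → if does (toℕ r <? i) then sumℕ (ferrersℕ d r) else 0)
σ≡firstColumns-firstRows {n} d i = trans (sumℤ-cong row) (sumℤ-difference column< row<)
  where
  row : ∀ r → (if does (toℕ r <? i) then sumℤ (diffM d r) else + 0)
            ≡ + (if does (toℕ r <? i) then sumℕ (λ c → ferrersℕ d c r) else 0)
              ℤ.- + (if does (toℕ r <? i) then sumℕ (ferrersℕ d r) else 0)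
  row r with does (toℕ r <? i)
  ... | true  = diffM-rowSum d r
  ... | false = refl
  column< row< : Fin n → ℕ
  column< r = if does (toℕ r <? i) then sumℕ (λ c → ferrersℕ d c r) else 0
  row< r = if does (toℕ r <? i) then sumℕ (ferrersℕ d r) else 0

σ≡prefixOnes-degrees : ∀ {n i} (d : Fin n → ℕ) → (∀ r → d r ≤ n ∸ 1) → i ≤ n →
  σ d i ≡ + sumℕ (prefixOnes d i) ℤ.- + sumℕ (λ r → if does (toℕ r <? i) then d r else 0)
σ≡prefixOnes-degrees {n} {i} d d≤n∸1 i≤n = trans (σ≡firstColumns-firstRows d i)
  (cong₂ (λ x y → + x ℤ.- + y) (ferrersℕ-firstColumns d i≤n) (sumℕ-cong rows))
  where
  rows : ∀ r → (if does (toℕ r <? i) then sumℕ (ferrersℕ d r) else 0) ≡ (if does (toℕ r <? i) then d r else 0)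
  rows r = if-cong-then (does (toℕ r <? i)) (trans (ferrersℕ-rowSum d r) (m≥n⇒m⊓n≡n (d≤n∸1 r)))

-- Degree sequences

deg≤n∸1 : ∀ {n} (G : Graph n) i → deg G i ≤ n ∸ 1
deg≤n∸1 {suc n} G i = begin
  deg G i                              ≡⟨ sumℕ-remove adjacent i ⟩
  adjacent i + sumℕ (adjacent ∘ Fin.punchIn i)
                                       ≡⟨ cong (_+ sumℕ (adjacent ∘ Fin.punchIn i)) (if-cong (Graph.irrefl G i)) ⟩
  sumℕ (adjacent ∘ Fin.punchIn i)      ≤⟨ sumℕ-≤ (adjacent ∘ Fin.punchIn i) (adjacent≤1 ∘ Fin.punchIn i) ⟩
  n * 1                                ≡⟨ *-identityʳ n ⟩
  n                                    ∎
  where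
  open ≤-Reasoning
  adjacent : Fin (suc n) → ℕ
  adjacent j = if Graph.adj G i j then 1 else 0
  adjacent≤1 : ∀ j → adjacent j ≤ 1
  adjacent≤1 j with Graph.adj G i j
  ... | true  = ≤-refl
  ... | false = z≤n

IsDegreeSequence⇒≤n∸1 : ∀ {n} {d : Fin n → ℕ} → IsDegreeSequence d → ∀ r → d r ≤ n ∸ 1
IsDegreeSequence⇒≤n∸1 (_ , G , degG≡d) r = subst (_≤ _) (degG≡d r) (deg≤n∸1 G r)

maxFin-witness : ∀ {n k} (g : Fin n → ℕ) → 0 < k → k ≤ maxFin g → ∃ λ j → k ≤ g j
maxFin-witness {zero}  g 0<k k≤0 = contradiction (≤-trans 0<k k≤0) λ ()
maxFin-witness {suc n} g 0<k k≤max with ⊔-sel (g Fin.zero) (maxFin (g ∘ Fin.suc))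
... | inj₁ max≡g₀ = Fin.zero , subst (_ ≤_) max≡g₀ k≤max
... | inj₂ max≡rest =
  let j , k≤gj = maxFin-witness (g ∘ Fin.suc) 0<k (subst (_ ≤_) max≡rest k≤max) in Fin.suc j , k≤gj

mOf-lowerBound : ∀ {n} {f : Fin n → ℕ} → Nonincreasing f → ∀ {i} → i ≤ mOf f →
  ∀ c → toℕ c < i → i ∸ 1 ≤ f c
mOf-lowerBound {f = f} f↓ {suc i} i≤m c c<i with maxFin-witness _ z<s i≤m
... | j , i≤gj = witness (toℕ j ≤? f j) i≤gj
  where
  witness : (j≤fj? : Dec (toℕ j ≤ f j)) → suc i ≤ (if does j≤fj? then suc (toℕ j) else 0) → i ≤ f c
  witness (yes j≤fj) (s≤s i≤j) = ≤-trans i≤j (≤-trans j≤fj (f↓ c j (≤-trans (s≤s⁻¹ c<i) i≤j)))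

complement-nonincreasing : ∀ {n} {d : Fin n → ℕ} → Nonincreasing d → Nonincreasing (complement d)
complement-nonincreasing {n} d↓ a b a≤b = ∸-monoʳ-≤ (n ∸ 1) (d↓ (opposite b) (opposite a) b̄≤ā)
  where
  b̄≤ā : toℕ (opposite b) ≤ toℕ (opposite a)
  b̄≤ā = subst₂ _≤_ (sym (opposite-prop b)) (sym (opposite-prop a)) (∸-monoʳ-≤ n (s≤s a≤b))

complement-upperBound : ∀ {n} {d : Fin n → ℕ} → IsDegreeSequence d → ∀ {i} →
  n ∸ mOf (complement d) ≤ i → ∀ c → i ≤ toℕ c → d c ≤ i
complement-upperBound {n} {d} ds {i} n∸m≤i c i≤c =
  ∸-cancelʳ-≤ (IsDegreeSequence⇒≤n∸1 ds c) (subst₂ _≤_ swap d̄≡ large)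
  where
  m : ℕ
  m = mOf (complement d)
  k≤m : n ∸ i ≤ m
  k≤m = m≤n+o⇒m∸n≤o n i (≤-trans (m≤n+m∸n n m) (subst (m + (n ∸ m) ≤_) (+-comm m i) (+-monoʳ-≤ m n∸m≤i)))
  large : n ∸ i ∸ 1 ≤ complement d (opposite c)
  large = mOf-lowerBound (complement-nonincreasing (proj₁ ds)) k≤m
            (opposite c) (Equivalence.from (opposite<∸⇔≤ i c) i≤c)
  swap : n ∸ i ∸ 1 ≡ n ∸ 1 ∸ i
  swap = trans (∸-+-assoc n i 1) (trans (cong (n ∸_) (+-comm i 1)) (sym (∸-+-assoc n 1 i)))
  d̄≡ : complement d (opposite c) ≡ n ∸ 1 ∸ d c
  d̄≡ = cong (λ j → n ∸ 1 ∸ d j) (opposite-involutive c)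

Δ-complement : ∀ {n} (d : Fin n → ℕ) i →
  Δ (n ∸ i) (complement d) ≡
    + ((n ∸ i) * (n ∸ i ∸ 1) + sumℕ (λ c → if does (toℕ c <? i) then (n ∸ i) ⊓ (n ∸ 1 ∸ d c) else 0))
    ℤ.- + sumℕ (λ c → if does (i ≤? toℕ c) then n ∸ 1 ∸ d c else 0)
Δ-complement {n} d i = cong₂ (λ x y → + ((n ∸ i) * (n ∸ i ∸ 1) + x) ℤ.- + y)
  (trans (sumℕ-opposite-from i (λ j → (n ∸ i) ⊓ complement d j))
         (sumℕ-cong λ c → if-cong-then (does (toℕ c <? i))
                            (cong (λ j → (n ∸ i) ⊓ (n ∸ 1 ∸ d j)) (opposite-involutive c))))
  (trans (sumℕ-opposite-below i (complement d))
         (sumℕ-cong λ c → if-cong-then (does (i ≤? toℕ c))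
                            (cong (λ j → n ∸ 1 ∸ d j) (opposite-involutive c))))

-- The two ranges of i

prefixOnes-split : ∀ {n i} (d : Fin n → ℕ) → (∀ c → toℕ c < i → i ∸ 1 ≤ d c) → ∀ c →
  prefixOnes d i c ≡ (if does (toℕ c <? i) then i ∸ 1 else 0) + (if does (i ≤? toℕ c) then i ⊓ d c else 0)
prefixOnes-split {i = i} d large c with <-≤-connex (toℕ c) i
... | inj₁ c<i = begin
  offDiagonal (toℕ c) i ⊓ d c  ≡⟨ cong (_⊓ d c) (offDiagonal-< c<i) ⟩
  (i ∸ 1) ⊓ d c                ≡⟨ m≤n⇒m⊓n≡m (large c c<i) ⟩
  i ∸ 1                        ≡⟨ +-identityʳ (i ∸ 1) ⟨
  (i ∸ 1) + 0                  ≡⟨ cong₂ _+_ (if-yes (toℕ c <? i) c<i) (if-no (i ≤? toℕ c) (<⇒≱ c<i)) ⟨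
  _                            ∎
  where open ≡-Reasoning
... | inj₂ i≤c = begin
  offDiagonal (toℕ c) i ⊓ d c  ≡⟨ cong (_⊓ d c) (offDiagonal-≥ i≤c) ⟩
  i ⊓ d c                      ≡⟨ cong₂ _+_ (if-no (toℕ c <? i) (≤⇒≯ i≤c)) (if-yes (i ≤? toℕ c) i≤c) ⟨
  _                            ∎
  where open ≡-Reasoning

σ≡Δ : ∀ {n} (d : Fin n → ℕ) → IsDegreeSequence d → ∀ {i} → i ≤ n → i ≤ mOf d → σ d i ≡ Δ i d
σ≡Δ {n} d ds {i} i≤n i≤m = trans (σ≡prefixOnes-degrees d (IsDegreeSequence⇒≤n∸1 ds) i≤n)
  (cong (λ x → + x ℤ.- + sumℕ (λ r → if does (toℕ r <? i) then d r else 0)) columns)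
  where
  open ≡-Reasoning
  below above : Fin n → ℕ
  below c = if does (toℕ c <? i) then i ∸ 1 else 0
  above c = if does (i ≤? toℕ c) then i ⊓ d c else 0
  columns : sumℕ (prefixOnes d i) ≡ i * (i ∸ 1) + sumℕ above
  columns = begin
    sumℕ (prefixOnes d i)           ≡⟨ sumℕ-cong (prefixOnes-split d (mOf-lowerBound (proj₁ ds) i≤m)) ⟩
    sumℕ (λ c → below c + above c)  ≡⟨ sumℕ-distrib-+ below above ⟩
    sumℕ below + sumℕ above         ≡⟨ cong (_+ sumℕ above) (sumℕ-below-const i≤n (i ∸ 1)) ⟩
    i * (i ∸ 1) + sumℕ above        ∎

-- Summed over the rows this is the claimed identity σ(d,i) = Δ_{n-i}(d̄), with i(n-i)
-- added to both sides so that nothing is subtracted.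
prefixOnes-complement : ∀ {n i a e} → i ≤ n → e ≤ n ∸ 1 → (i ≤ a → e ≤ i) →
  offDiagonal a i ⊓ e + (if does (i ≤? a) then n ∸ 1 ∸ e else 0) + (if does (a <? i) then n ∸ i else 0)
    ≡ (if does (i ≤? a) then n ∸ 1 else 0) + (if does (a <? i) then (n ∸ i) ⊓ (n ∸ 1 ∸ e) else 0)
      + (if does (a <? i) then e else 0)
prefixOnes-complement {n} {i} {a} {e} i≤n e≤n∸1 small with <-≤-connex a i
... | inj₁ a<i = begin
  offDiagonal a i ⊓ e + (if does (i ≤? a) then n ∸ 1 ∸ e else 0) + (if does (a <? i) then k else 0)
    ≡⟨ cong₂ _+_ (cong₂ _+_ (cong (_⊓ e) (offDiagonal-< a<i)) (if-no (i ≤? a) (<⇒≱ a<i)))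
                 (if-yes (a <? i) a<i) ⟩
  (i ∸ 1) ⊓ e + 0 + k                 ≡⟨ cong (_+ k) (+-identityʳ _) ⟩
  (i ∸ 1) ⊓ e + k                     ≡⟨ m⊓o+n≡n⊓[m+n∸o]+o (i ∸ 1) k (subst (e ≤_) n∸1≡ e≤n∸1) ⟩
  k ⊓ ((i ∸ 1) + k ∸ e) + e           ≡⟨ cong (λ x → k ⊓ (x ∸ e) + e) n∸1≡ ⟨
  k ⊓ (n ∸ 1 ∸ e) + e                 ≡⟨ cong₂ _+_ (cong₂ _+_ (if-no (i ≤? a) (<⇒≱ a<i)) (if-yes (a <? i) a<i))
                                                   (if-yes (a <? i) a<i) ⟨
  _ ∎
  where
  open ≡-Reasoning
  k : ℕ
  k = n ∸ i
  n∸1≡ : n ∸ 1 ≡ (i ∸ 1) + k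
  n∸1≡ = n∸1≡[i∸1]+[n∸i] (≤-<-trans z≤n a<i) i≤n
... | inj₂ i≤a = begin
  offDiagonal a i ⊓ e + (if does (i ≤? a) then n ∸ 1 ∸ e else 0) + (if does (a <? i) then n ∸ i else 0)
    ≡⟨ cong₂ _+_ (cong₂ _+_ (cong (_⊓ e) (offDiagonal-≥ i≤a)) (if-yes (i ≤? a) i≤a))
                 (if-no (a <? i) (≤⇒≯ i≤a)) ⟩
  i ⊓ e + (n ∸ 1 ∸ e) + 0             ≡⟨ +-identityʳ _ ⟩
  i ⊓ e + (n ∸ 1 ∸ e)                 ≡⟨ cong (_+ (n ∸ 1 ∸ e)) (m≥n⇒m⊓n≡n (small i≤a)) ⟩
  e + (n ∸ 1 ∸ e)                     ≡⟨ m+[n∸m]≡n e≤n∸1 ⟩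
  n ∸ 1                               ≡⟨ trans (+-identityʳ _) (+-identityʳ _) ⟨
  n ∸ 1 + 0 + 0                       ≡⟨ cong₂ _+_ (cong₂ _+_ (if-yes (i ≤? a) i≤a) (if-no (a <? i) (≤⇒≯ i≤a)))
                                                   (if-no (a <? i) (≤⇒≯ i≤a)) ⟨
  _ ∎
  where open ≡-Reasoning

complement-balance : ∀ {n} (d : Fin n → ℕ) → IsDegreeSequence d → ∀ {i} → i ≤ n →
  n ∸ mOf (complement d) ≤ i →
  sumℕ (prefixOnes d i) + sumℕ (λ c → if does (i ≤? toℕ c) then n ∸ 1 ∸ d c else 0)
    ≡ (n ∸ i) * (n ∸ i ∸ 1) + sumℕ (λ c → if does (toℕ c <? i) then (n ∸ i) ⊓ (n ∸ 1 ∸ d c) else 0)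
      + sumℕ (λ c → if does (toℕ c <? i) then d c else 0)
complement-balance {n} d ds {i} i≤n n∸m≤i = +-cancelʳ-≡ (i * k) _ _ (begin
  X + sumℕ late′ + i * k
    ≡⟨ cong (_+_ (X + sumℕ late′)) (sumℕ-below-const i≤n k) ⟨
  X + sumℕ late′ + sumℕ weight
    ≡⟨ sumℕ-distrib-+₃ (prefixOnes d i) late′ weight ⟨
  sumℕ (λ c → prefixOnes d i c + late′ c + weight c)
    ≡⟨ sumℕ-cong (λ c → prefixOnes-complement i≤n (IsDegreeSequence⇒≤n∸1 ds c)
                                              (complement-upperBound ds n∸m≤i c)) ⟩
  sumℕ (λ c → late c + early′ c + early c)
    ≡⟨ sumℕ-distrib-+₃ late early′ early ⟩
  sumℕ late + P + T
    ≡⟨ cong (λ x → x + P + T) (sumℕ-from (≤⇒≤′ i≤n) (n ∸ 1)) ⟩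
  k * (n ∸ 1) + P + T
    ≡⟨ cong (λ x → k * (x ∸ 1) + P + T) (m+[n∸m]≡n i≤n) ⟨
  k * (i + k ∸ 1) + P + T
    ≡⟨ cong (λ x → x + P + T) (k*[i+k∸1]≡k*[k∸1]+i*k i k) ⟩
  k * (k ∸ 1) + i * k + P + T
    ≡⟨ a+b+c+d≡a+c+d+b (k * (k ∸ 1)) (i * k) P T ⟩
  k * (k ∸ 1) + P + T + i * k ∎)
  where
  open ≡-Reasoning
  k : ℕ
  k = n ∸ i
  early early′ late late′ weight : Fin n → ℕ
  early c  = if does (toℕ c <? i) then d c else 0
  early′ c = if does (toℕ c <? i) then k ⊓ (n ∸ 1 ∸ d c) else 0
  late c   = if does (i ≤? toℕ c) then n ∸ 1 else 0
  late′ c  = if does (i ≤? toℕ c) then n ∸ 1 ∸ d c else 0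
  weight c = if does (toℕ c <? i) then k else 0
  X P T : ℕ
  X = sumℕ (prefixOnes d i)
  P = sumℕ early′
  T = sumℕ early

σ≡Δ-complement : ∀ {n} (d : Fin n → ℕ) → IsDegreeSequence d → ∀ {i} → i ≤ n →
  n ∸ mOf (complement d) ≤ i → σ d i ≡ Δ (n ∸ i) (complement d)
σ≡Δ-complement {n} d ds {i} i≤n n∸m≤i = begin
  σ d i
    ≡⟨ σ≡prefixOnes-degrees d (IsDegreeSequence⇒≤n∸1 ds) i≤n ⟩
  + X ℤ.- + T
    ≡⟨ [+a]-[+b]≡[+c]-[+d] X T (k * (k ∸ 1) + P) Q (complement-balance d ds i≤n n∸m≤i) ⟩
  + (k * (k ∸ 1) + P) ℤ.- + Q
    ≡⟨ Δ-complement d i ⟨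
  Δ k (complement d) ∎
  where
  open ≡-Reasoning
  k X P Q T : ℕ
  k = n ∸ i
  X = sumℕ (prefixOnes d i)
  P = sumℕ (λ c → if does (toℕ c <? i) then k ⊓ (n ∸ 1 ∸ d c) else 0)
  Q = sumℕ (λ c → if does (i ≤? toℕ c) then n ∸ 1 ∸ d c else 0)
  T = sumℕ (λ c → if does (toℕ c <? i) then d c else 0)

theorem3p4 : (n : ℕ) (d : Fin n → ℕ) → IsDegreeSequence d →
    (i : ℕ) → i ≤ n →
      (i ≤ mOf d → σ d i ≡ Δ i d) ×
      (n ∸ mOf (complement d) ≤ i → σ d i ≡ Δ (n ∸ i) (complement d))
theorem3p4 n d ds i i≤n = σ≡Δ d ds i≤n , σ≡Δ-complement d ds i≤n
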